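{- Let $f$ be any honest function. Then $f\leq_{PR}\hat{G}^{\alpha^f}$, i.e. $f$ is primitive recursive in $\hat{G}^{\alpha^f}$.
   Context: A function is elementary if it can be generated from $2^x$, $\max$, $0$, successor and projections by composition and bounded primitive recursion; a relation is elementary if its characteristic function is. $\phi\leq_{PR}\psi$ means $\phi$ can be generated from the initial functions $\psi$, $2^x$, $\max$, $0$, successor, projections by composition and (unbounded) primitive recursion. Rationals are coded into $\mathbb{N}$ in a standard elementary way. A function $f:\mathbb{N}\to\mathbb{N}$ is honest if $f(x)\le f(x+1)$, $f(x)\geq 2^x$ for all $x$, and the relation $f(x)=y$ is elementary. Let $P_i$ denote the $i$-th prime ($P_0=2$). Define $g(0)=1$, $g(j+1)=P_j^{2(j+2)(g(j)+1)^3}$, $h(i)=g(f(i)+i)$, $\alpha^f_n=\sum_{i=0}^nP_i^{ -h(i)}$, $\alpha^f=\lim_n\alpha^f_n$ (an irrational in $(0,1)$). For irrational $\alpha\in(0,1)$ and base $b\ge 2$ write uniquely $\alpha=\sum_{i\ge1}\mathtt{D}_ib^{ -k_i}$ with $\mathtt{D}_i\in\{1,\dots,b-1\}$, $0<k_1<k_2<\cdots$; the general sum approximation from below is $\hat{G}^\alpha:\mathbb{N}\times\mathbb{N}\to\mathbb{Q}$ with $\hat{G}^\alpha(b,0)=0$, $\hat{G}^\alpha(b,n)=\mathtt{D}_nb^{ -k_n}$ for $n>0$ and $b\ge 2$, and $\hat{G}^\alpha(b,n)=0$ for $b<2$. -}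

module Defs where

open import Data.Nat as ℕ using (ℕ; zero; suc; _+_; _*_; _^_; _≤_; _<_; _⊔_; NonZero; _!; >-nonZero)
open import Data.Nat.Properties using (m^n≢0; ≤-refl; ≤-trans; n≤1+n)
open import Data.Nat.DivMod using (_/_)
open import Data.Nat.Primality using (prime?)
open import Data.Integer as ℤ using (ℤ; +_; -[1+_])
open import Data.Rational as ℚ using (ℚ; 0ℚ)
open import Data.Fin using (Fin)
open import Data.Vec using (Vec; []; _∷_; lookup; map; head)
open import Data.Bool using (true; false)
open import Data.Product using (Σ; _×_; ∃)
open import Relation.Nullary using (does)
open import Relation.Binary.PropositionalEquality using (_≡_)

rec : ∀ {n} → (Vec ℕ n → ℕ) → (Vec ℕ (suc (suc n)) → ℕ) → Vec ℕ (suc n) → ℕ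
rec g h (zero  ∷ ys) = g ys
rec g h (suc x ∷ ys) = h (x ∷ rec g h (x ∷ ys) ∷ ys)

apply : ∀ {m n} → Vec (Vec ℕ n → ℕ) m → Vec ℕ n → Vec ℕ m
apply []       v = []
apply (g ∷ gs) v = g v ∷ apply gs v

data AllEl {n : ℕ} : ∀ {m} → Vec (Vec ℕ n → ℕ) m → Set

data Elementary : (n : ℕ) → (Vec ℕ n → ℕ) → Set where
  el-exp  : Elementary 1 (λ v → 2 ^ head v)
  el-max  : Elementary 2 (λ v → lookup v Fin.zero ⊔ lookup v (Fin.suc Fin.zero))
  el-zero : Elementary 0 (λ _ → 0)
  el-suc  : Elementary 1 (λ v → suc (head v))
  el-proj : ∀ {n} (i : Fin n) → Elementary n (λ v → lookup v i)
  el-comp : ∀ {m n} {g : Vec ℕ m → ℕ} {hs : Vec (Vec ℕ n → ℕ) m} →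
            Elementary m g → AllEl hs → Elementary n (λ v → g (apply hs v))
  el-brec : ∀ {n} {g : Vec ℕ n → ℕ} {h : Vec ℕ (suc (suc n)) → ℕ}
            {j : Vec ℕ (suc n) → ℕ} →
            Elementary n g → Elementary (suc (suc n)) h → Elementary (suc n) j →
            (∀ v → rec g h v ≤ j v) → Elementary (suc n) (rec g h)
  el-ext  : ∀ {n} {f f' : Vec ℕ n → ℕ} →
            Elementary n f → (∀ v → f v ≡ f' v) → Elementary n f'

data AllEl {n} where
  []  : AllEl []
  _∷_ : ∀ {m} {g} {gs : Vec (Vec ℕ n → ℕ) m} →
        Elementary n g → AllEl gs → AllEl (g ∷ gs)

data PRin (ψ : Vec ℕ 2 → ℕ) : (n : ℕ) → (Vec ℕ n → ℕ) → Set
data AllPR (ψ : Vec ℕ 2 → ℕ) {n : ℕ} : ∀ {m} → Vec (Vec ℕ n → ℕ) m → Set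

data PRin ψ where
  pr-oracle : PRin ψ 2 ψ
  pr-exp  : PRin ψ 1 (λ v → 2 ^ head v)
  pr-max  : PRin ψ 2 (λ v → lookup v Fin.zero ⊔ lookup v (Fin.suc Fin.zero))
  pr-zero : PRin ψ 0 (λ _ → 0)
  pr-suc  : PRin ψ 1 (λ v → suc (head v))
  pr-proj : ∀ {n} (i : Fin n) → PRin ψ n (λ v → lookup v i)
  pr-comp : ∀ {m n} {g : Vec ℕ m → ℕ} {hs : Vec (Vec ℕ n → ℕ) m} →
            PRin ψ m g → AllPR ψ hs → PRin ψ n (λ v → g (apply hs v))
  pr-rec  : ∀ {n} {g : Vec ℕ n → ℕ} {h : Vec ℕ (suc (suc n)) → ℕ} →
            PRin ψ n g → PRin ψ (suc (suc n)) h → PRin ψ (suc n) (rec g h)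
  pr-ext  : ∀ {n} {f f' : Vec ℕ n → ℕ} →
            PRin ψ n f → (∀ v → f v ≡ f' v) → PRin ψ n f'

data AllPR ψ where
  []  : AllPR ψ []
  _∷_ : ∀ {m} {g} {gs : Vec (Vec ℕ _ → ℕ) m} →
        PRin ψ _ g → AllPR ψ gs → AllPR ψ (g ∷ gs)

graphχ : (ℕ → ℕ) → Vec ℕ 2 → ℕ
graphχ f (x ∷ y ∷ []) with does (f x ℕ.≟ y)
... | true  = 1
... | false = 0

Honest : (ℕ → ℕ) → Set
Honest f = (∀ x → f x ≤ f (suc x)) × (∀ x → 2 ^ x ≤ f x) × Elementary 2 (graphχ f)

cantor : ℕ → ℕ → ℕ
cantor x y = ((x + y) * suc (x + y)) / 2 + y

codeℤ : ℤ → ℕ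
codeℤ (+ n)     = 2 * n
codeℤ -[1+ n ]  = suc (2 * n)

codeℚ : ℚ → ℕ
codeℚ q = cantor (codeℤ (ℚ.numerator q)) (ℚ.denominatorℕ q)

-- Primes: P 0 = 2, P (i+1) = least prime > P i (searched up to P i ! + 1)

search : ℕ → ℕ → ℕ
search s zero = s
search s (suc k) with does (prime? s)
... | true  = s
... | false = search (suc s) k

search-≥ : ∀ s k → s ≤ search s k
search-≥ s zero = ≤-refl
search-≥ s (suc k) with does (prime? s)
... | true  = ≤-refl
... | false = ≤-trans (n≤1+n s) (search-≥ (suc s) k)

P : ℕ → ℕ
P zero    = 2
P (suc i) = search (suc (P i)) (P i !)

P-nz : ∀ i → NonZero (P i)
P-nz zero    = _
P-nz (suc i) = >-nonZero (≤-trans (ℕ.s≤s ℕ.z≤n) (search-≥ (suc (P i)) (P i !)))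

-- The real α^f, represented by its defining sequence of partial sums α^f_n

gfun : ℕ → ℕ
gfun zero    = 1
gfun (suc j) = P j ^ (2 * (j + 2) * (gfun j + 1) ^ 3)

hfun : (ℕ → ℕ) → ℕ → ℕ
hfun f i = gfun (f i + i)

Pinv : ℕ → ℕ → ℚ
Pinv i e = (+ 1) ℚ./ (P i ^ e)
  where instance _ = P-nz i
                 _ = m^n≢0 (P i) e {{P-nz i}}

αseq : (ℕ → ℕ) → ℕ → ℚ
αseq f zero    = Pinv 0 (hfun f 0)
αseq f (suc n) = αseq f n ℚ.+ Pinv (suc n) (hfun f (suc n))

-- Two rational sequences have the same limit (both converge in the paper)

SameLimit : (ℕ → ℚ) → (ℕ → ℚ) → Set
SameLimit s t = ∀ (ε : ℚ) → 0ℚ ℚ.< ε →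
  ∃ λ N → ∀ m n → N ≤ m → N ≤ n → ℚ.∣ s m ℚ.- t n ∣ ℚ.< ε

-- General sum approximation from below Ĝ^α, for α = lim a (irrational,
-- in (0,1)). Base b ≥ 2 written as b = c + 2.

digitTerm : (c d k : ℕ) → ℚ
digitTerm c d k = (+ d) ℚ./ (suc (suc c) ^ k)
  where instance _ = m^n≢0 (suc (suc c)) k

partialSum : (c : ℕ) → (ℕ → ℕ) → (ℕ → ℕ) → ℕ → ℚ
partialSum c D k zero    = 0ℚ
partialSum c D k (suc m) = partialSum c D k m ℚ.+ digitTerm c (D (suc m)) (k (suc m))

-- (D, k) is the representation α = Σ_{i≥1} D_i b^{-k_i}, D_i ∈ {1..b-1},
-- 0 < k_1 < k_2 < ...  (k 0 := 0, D 0 unused)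
IsExpansion : (a : ℕ → ℚ) (c : ℕ) (D k : ℕ → ℕ) → Set
IsExpansion a c D k =
  (∀ i → 1 ≤ D (suc i) × D (suc i) < suc (suc c)) ×
  k 0 ≡ 0 × (∀ i → k i < k (suc i)) ×
  SameLimit (partialSum c D k) a

IsGhat : (a : ℕ → ℚ) → (ℕ → ℕ → ℚ) → Set
IsGhat a G =
  (∀ b n → b < 2 → G b n ≡ 0ℚ) ×
  (∀ c → G (suc (suc c)) 0 ≡ 0ℚ) ×
  (∀ c → Σ (ℕ → ℕ) λ D → Σ (ℕ → ℕ) λ k → IsExpansion a c D k ×
         (∀ n → G (suc (suc c)) (suc n) ≡ digitTerm c (D (suc n)) (k (suc n))))

oracle : (ℕ → ℕ → ℚ) → Vec ℕ 2 → ℕ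
oracle G (b ∷ n ∷ []) = codeℚ (G b n)

-- Let Q = αden f i = ∏_{j<i} P_j^{h(j)}, the denominator of α^f_{i-1}, and expand α = α^f in
-- base b = 2Q.  Then α^f_{i-1} is a single digit N₀/b, the tail α − α^f_{i-1} lies between
-- P_i^{-h(i)} and 2·2^{-h(i)}, and 3·b^{f(i)} ≤ 2^{h(i)} by the growth of g.  If the second
-- nonzero digit D₂ b^{-k₂} of α sat at a position k₂ ≤ f(i), the two-digit sum
-- D₁ b^{-k₁} + D₂ b^{-k₂} and N₀/b would be multiples of b^{-k₂} closer than b^{-k₂}, hence
-- equal, forcing b ∣ D₂.  So k₂ > f(i), and the code of Ĝ(b, 2) = D₂ b^{-k₂}, which is at least
-- its denominator, exceeds f(i).  As Q only depends on f below i, one primitive recursion computes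
-- Q and f(i) together, finding f(i) by a search below that oracle value through the elementary
-- graph of f.

module Submission where

open import Defs
open import Data.Nat as ℕ using (ℕ; zero; suc)
import Data.Nat.Properties
open import Data.Rational using (ℚ)
open import Data.Vec using (Vec; []; _∷_; head)
open import Data.Product using (_,_)
open import Relation.Binary.PropositionalEquality using (refl)

αden : (ℕ → ℕ) → ℕ → ℕ
αden f zero    = 1
αden f (suc i) = αden f i ℕ.* P i ℕ.^ hfun f i

module Characteristic where

  open import Data.Nat
  open import Data.Nat.Properties using (anyUpTo?; +-identityʳ; 0∸n≡0)
  open import Data.Bool using (Bool; true; false; _∧_; _∨_; not; if_then_else_)
  open import Relation.Nullary using (yes; no; does)
  open import Relation.Unary using (Decidable)
  open import Relation.Binary.PropositionalEquality using (_≡_; refl; sym; trans)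

  χ : Bool → ℕ
  χ true  = 1
  χ false = 0

  χ-∧ : ∀ a b → χ (a ∧ b) ≡ χ a * χ b
  χ-∧ true  true  = refl
  χ-∧ true  false = refl
  χ-∧ false _     = refl

  χ-∨ : ∀ a b → χ (a ∨ b) ≡ χ a ⊔ χ b
  χ-∨ true  true  = refl
  χ-∨ true  false = refl
  χ-∨ false _     = refl

  χ-not : ∀ a → χ (not a) ≡ 1 ∸ χ a
  χ-not true  = refl
  χ-not false = refl

  χ-≡ᵇ : ∀ m n → χ (m ≡ᵇ n) ≡ 1 ∸ ((m ∸ n) + (n ∸ m))
  χ-≡ᵇ zero    zero    = refl
  χ-≡ᵇ zero    (suc n) = sym (0∸n≡0 n)
  χ-≡ᵇ (suc m) zero    = sym (0∸n≡0 (m + 0))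
  χ-≡ᵇ (suc m) (suc n) = χ-≡ᵇ m n

  χ-≤ᵇ : ∀ m n → χ (m ≤ᵇ n) ≡ 1 ∸ (m ∸ n)
  χ-≤ᵇ zero          zero    = refl
  χ-≤ᵇ zero          (suc n) = refl
  χ-≤ᵇ (suc m)       zero    = sym (0∸n≡0 m)
  χ-≤ᵇ (suc zero)    (suc n) = χ-≤ᵇ zero n
  χ-≤ᵇ (suc (suc m)) (suc n) = χ-≤ᵇ (suc m) n

  χ-if : ∀ c a b → (if c then a else b) ≡ χ c * a + (1 ∸ χ c) * b
  χ-if true  a b = sym (trans (+-identityʳ (a + 0)) (+-identityʳ a))
  χ-if false a b = sym (+-identityʳ b)

  anyUpTo?-suc : ∀ {p} {P : ℕ → Set p} (P? : Decidable P) v →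
                 does (anyUpTo? P? (suc v)) ≡ does (P? v) ∨ does (anyUpTo? P? v)
  anyUpTo?-suc P? v with P? v | anyUpTo? P? v
  ... | yes _ | _     = refl
  ... | no _  | yes _ = refl
  ... | no _  | no _  = refl

module BoundedPrimality where

  open import Data.Nat
  open import Data.Nat.Properties
  open import Data.Nat.Divisibility using (divides; hasNonTrivialDivisor)
  open import Data.Nat.Primality using (Prime; prime; prime?)
  open import Data.Product using (∃; _×_; _,_)
  open import Function.Bundles using (_⇔_; mk⇔)
  open import Relation.Nullary using (Dec; ¬_; ¬?; _×-dec_; does)
  open import Relation.Nullary.Decidable using (does-⇔)
  open import Relation.Binary.PropositionalEquality using (_≡_; sym)

  Divisor≤ : ℕ → ℕ → Set
  Divisor≤ d s = ∃ λ q → q < suc s × q * d ≡ s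

  divisor≤? : ∀ d s → Dec (Divisor≤ d s)
  divisor≤? d s = anyUpTo? (λ q → q * d ≟ s) (suc s)

  HasFactorBelow : ℕ → Set
  HasFactorBelow s = ∃ λ d → d < s × 2 ≤ d × Divisor≤ d s

  hasFactorBelow? : ∀ s → Dec (HasFactorBelow s)
  hasFactorBelow? s = anyUpTo? (λ d → 2 ≤? d ×-dec divisor≤? d s) s

  primeTest? : ∀ s → Dec (2 ≤ s × ¬ HasFactorBelow s)
  primeTest? s = 2 ≤? s ×-dec ¬? (hasFactorBelow? s)

  primeTest⇔Prime : ∀ {s} → (2 ≤ s × ¬ HasFactorBelow s) ⇔ Prime s
  primeTest⇔Prime {s} = mk⇔ to from
    where
    to : 2 ≤ s × ¬ HasFactorBelow s → Prime s
    to (2≤s , noFactor) = prime {{n>1⇒nonTrivial 2≤s}} λ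
      { (hasNonTrivialDivisor {d} d<s (divides q s≡q*d)) →
          let instance _ = nonTrivial⇒nonZero d in
          noFactor (d , d<s , nonTrivial⇒n>1 d , q ,
                    s≤s (≤-trans (m≤m*n q d) (≤-reflexive (sym s≡q*d))) , sym s≡q*d) }
    from : Prime s → 2 ≤ s × ¬ HasFactorBelow s
    from (prime notComposite) =
      nonTrivial⇒n>1 s ,
      λ { (d , d<s , 2≤d , q , _ , q*d≡s) →
            notComposite (hasNonTrivialDivisor {{n>1⇒nonTrivial 2≤d}} d<s (divides q (sym q*d≡s))) }

  primeTest?≡prime? : ∀ s → does (primeTest? s) ≡ does (prime? s)
  primeTest?≡prime? s = does-⇔ primeTest⇔Prime (primeTest? s) (prime? s)

module PrimitiveRecursive (ψ : Vec ℕ 2 → ℕ) where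

  open import Data.Nat
  open import Data.Nat.Properties
  open import Data.Fin as Fin using ()
  open import Data.Vec using (Vec; []; _∷_; lookup)
  open import Data.Bool using (Bool; true; false; _∧_; not; if_then_else_)
  open import Relation.Nullary using (Dec; yes; no; does; _×-dec_)
  open import Relation.Nullary.Decidable using (dec-true; dec-false)
  open import Relation.Binary.PropositionalEquality
  open Characteristic
  open BoundedPrimality
  open import Data.Nat.Primality using (prime?)

  PR : (n : ℕ) → (Vec ℕ n → ℕ) → Set
  PR = PRin ψ

  PR₁ : (ℕ → ℕ) → Set
  PR₁ f = PR 1 (λ v → f (lookup v Fin.zero))

  PR₂ : (ℕ → ℕ → ℕ) → Set
  PR₂ f = PR 2 (λ v → f (lookup v Fin.zero) (lookup v (Fin.suc Fin.zero)))

  PR₃ : (ℕ → ℕ → ℕ → ℕ) → Set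
  PR₃ f = PR 3 (λ v → f (lookup v Fin.zero) (lookup v (Fin.suc Fin.zero))
                        (lookup v (Fin.suc (Fin.suc Fin.zero))))

  PR₄ : (ℕ → ℕ → ℕ → ℕ → ℕ) → Set
  PR₄ f = PR 4 (λ v → f (lookup v Fin.zero) (lookup v (Fin.suc Fin.zero))
                        (lookup v (Fin.suc (Fin.suc Fin.zero)))
                        (lookup v (Fin.suc (Fin.suc (Fin.suc Fin.zero)))))

  PRᵇ : (n : ℕ) → (Vec ℕ n → Bool) → Set
  PRᵇ n p = PR n (λ v → χ (p v))

  x₀ : ∀ {n} → PR (suc n) (λ v → lookup v Fin.zero)
  x₀ = pr-proj Fin.zero

  x₁ : ∀ {n} → PR (2 + n) (λ v → lookup v (Fin.suc Fin.zero))
  x₁ = pr-proj (Fin.suc Fin.zero)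

  x₂ : ∀ {n} → PR (3 + n) (λ v → lookup v (Fin.suc (Fin.suc Fin.zero)))
  x₂ = pr-proj (Fin.suc (Fin.suc Fin.zero))

  x₃ : ∀ {n} → PR (4 + n) (λ v → lookup v (Fin.suc (Fin.suc (Fin.suc Fin.zero))))
  x₃ = pr-proj (Fin.suc (Fin.suc (Fin.suc Fin.zero)))

  comp₁ : ∀ {n} (g : ℕ → ℕ) {a : Vec ℕ n → ℕ} → PR₁ g → PR n a → PR n (λ v → g (a v))
  comp₁ g G A = pr-comp G (A ∷ [])

  comp₂ : ∀ {n} (g : ℕ → ℕ → ℕ) {a b : Vec ℕ n → ℕ} →
          PR₂ g → PR n a → PR n b → PR n (λ v → g (a v) (b v))
  comp₂ g G A B = pr-comp G (A ∷ B ∷ [])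

  comp₃ : ∀ {n} (g : ℕ → ℕ → ℕ → ℕ) {a b c : Vec ℕ n → ℕ} →
          PR₃ g → PR n a → PR n b → PR n c → PR n (λ v → g (a v) (b v) (c v))
  comp₃ g G A B C = pr-comp G (A ∷ B ∷ C ∷ [])

  const : ∀ {n} k → PR n (λ _ → k)
  const zero    = pr-comp pr-zero []
  const (suc k) = pr-comp pr-suc (const k ∷ [])

  primrec : ∀ {n} {F : Vec ℕ (suc n) → ℕ} {g : Vec ℕ n → ℕ} {h : Vec ℕ (2 + n) → ℕ} →
            PR n g → PR (2 + n) h →
            (∀ ys → F (0 ∷ ys) ≡ g ys) → (∀ x ys → F (suc x ∷ ys) ≡ h (x ∷ F (x ∷ ys) ∷ ys)) →
            PR (suc n) F
  primrec {F = F} {g} {h} G H base step = pr-ext (pr-rec G H) agree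
    where
    agree : ∀ v → rec g h v ≡ F v
    agree (zero  ∷ ys) = sym (base ys)
    agree (suc x ∷ ys) = trans (cong (λ r → h (x ∷ r ∷ ys)) (agree (x ∷ ys))) (sym (step x ys))

  primrec₁ : (F : ℕ → ℕ) (h : ℕ → ℕ → ℕ) → PR₂ h → (∀ x → F (suc x) ≡ h x (F x)) → PR₁ F
  primrec₁ F h H step = primrec (const (F 0)) H (λ _ → refl) (λ x _ → step x)

  primrec₂ : (F : ℕ → ℕ → ℕ) (g : ℕ → ℕ) (h : ℕ → ℕ → ℕ → ℕ) → PR₁ g → PR₃ h →
             (∀ y → F 0 y ≡ g y) → (∀ x y → F (suc x) y ≡ h x (F x y) y) → PR₂ F
  primrec₂ F g h G H base step =
    primrec G H (λ { (y ∷ []) → base y }) (λ { x (y ∷ []) → step x y })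

  primrec₃ : (F : ℕ → ℕ → ℕ → ℕ) (g : ℕ → ℕ → ℕ) (h : ℕ → ℕ → ℕ → ℕ → ℕ) →
             PR₂ g → PR₄ h →
             (∀ y z → F 0 y z ≡ g y z) → (∀ x y z → F (suc x) y z ≡ h x (F x y z) y z) → PR₃ F
  primrec₃ F g h G H base step =
    primrec G H (λ { (y ∷ z ∷ []) → base y z }) (λ { x (y ∷ z ∷ []) → step x y z })

  flip-PR : (F : ℕ → ℕ → ℕ) → PR₂ F → PR₂ (λ x y → F y x)
  flip-PR F FP = comp₂ F FP x₁ x₀

  suc-PR : PR₁ suc
  suc-PR = pr-ext pr-suc λ { (x ∷ []) → refl }

  +-PR : PR₂ _+_
  +-PR = primrec₂ _+_ (λ y → y) (λ _ r _ → suc r) x₀ (comp₁ suc suc-PR x₁)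
                  (λ _ → refl) (λ _ _ → refl)

  *-PR : PR₂ _*_
  *-PR = primrec₂ _*_ (λ _ → 0) (λ _ r y → y + r) (const 0) (comp₂ _+_ +-PR x₂ x₁)
                  (λ _ → refl) (λ _ _ → refl)

  ^-PR : PR₂ _^_
  ^-PR = flip-PR (λ y x → x ^ y)
    (primrec₂ (λ y x → x ^ y) (λ _ → 1) (λ _ r x → x * r) (const 1) (comp₂ _*_ *-PR x₂ x₁)
              (λ _ → refl) (λ _ _ → refl))

  pred-PR : PR₁ pred
  pred-PR = primrec₁ pred (λ x _ → x) x₀ (λ _ → refl)

  ∸-PR : PR₂ _∸_
  ∸-PR = flip-PR (λ y x → x ∸ y)
    (primrec₂ (λ y x → x ∸ y) (λ x → x) (λ _ r _ → pred r) x₀ (comp₁ pred pred-PR x₁)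
              (λ _ → refl) (λ y x → sym (pred[m∸n]≡m∸[1+n] x y)))

  !-PR : PR₁ _!
  !-PR = primrec₁ _! (λ x r → suc x * r) (comp₂ _*_ *-PR (comp₁ suc suc-PR x₀) x₁) (λ _ → refl)

  infixl 6 _+ᴾ_ _∸ᴾ_
  infixl 7 _*ᴾ_
  infixr 8 _^ᴾ_

  sucᴾ : ∀ {n} {a : Vec ℕ n → ℕ} → PR n a → PR n (λ v → suc (a v))
  sucᴾ = comp₁ suc suc-PR

  _+ᴾ_ : ∀ {n} {a b : Vec ℕ n → ℕ} → PR n a → PR n b → PR n (λ v → a v + b v)
  _+ᴾ_ = comp₂ _+_ +-PR

  _*ᴾ_ : ∀ {n} {a b : Vec ℕ n → ℕ} → PR n a → PR n b → PR n (λ v → a v * b v)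
  _*ᴾ_ = comp₂ _*_ *-PR

  _^ᴾ_ : ∀ {n} {a b : Vec ℕ n → ℕ} → PR n a → PR n b → PR n (λ v → a v ^ b v)
  _^ᴾ_ = comp₂ _^_ ^-PR

  _∸ᴾ_ : ∀ {n} {a b : Vec ℕ n → ℕ} → PR n a → PR n b → PR n (λ v → a v ∸ b v)
  _∸ᴾ_ = comp₂ _∸_ ∸-PR

  ≡ᵇ-PR : ∀ {n} {a b : Vec ℕ n → ℕ} → PR n a → PR n b → PRᵇ n (λ v → a v ≡ᵇ b v)
  ≡ᵇ-PR {a = a} {b} A B = pr-ext (const 1 ∸ᴾ ((A ∸ᴾ B) +ᴾ (B ∸ᴾ A))) (λ v → sym (χ-≡ᵇ (a v) (b v)))

  ≤ᵇ-PR : ∀ {n} {a b : Vec ℕ n → ℕ} → PR n a → PR n b → PRᵇ n (λ v → a v ≤ᵇ b v)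
  ≤ᵇ-PR {a = a} {b} A B = pr-ext (const 1 ∸ᴾ (A ∸ᴾ B)) (λ v → sym (χ-≤ᵇ (a v) (b v)))

  ∧-PR : ∀ {n} {p q : Vec ℕ n → Bool} → PRᵇ n p → PRᵇ n q → PRᵇ n (λ v → p v ∧ q v)
  ∧-PR {p = p} {q} Pp Pq = pr-ext (Pp *ᴾ Pq) (λ v → sym (χ-∧ (p v) (q v)))

  not-PR : ∀ {n} {p : Vec ℕ n → Bool} → PRᵇ n p → PRᵇ n (λ v → not (p v))
  not-PR {p = p} Pp = pr-ext (const 1 ∸ᴾ Pp) (λ v → sym (χ-not (p v)))

  if-PR : ∀ {n} {p : Vec ℕ n → Bool} {a b : Vec ℕ n → ℕ} →
          PRᵇ n p → PR n a → PR n b → PR n (λ v → if p v then a v else b v)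
  if-PR {p = p} {a} {b} Pp A B =
    pr-ext (Pp *ᴾ A +ᴾ (const 1 ∸ᴾ Pp) *ᴾ B) (λ v → sym (χ-if (p v) (a v) (b v)))

  anyUpTo-PR : {Q : ℕ → ℕ → ℕ → Set} (Q? : ∀ u y z → Dec (Q u y z)) →
               PR₃ (λ u y z → χ (does (Q? u y z))) →
               ∀ {n} {t a b : Vec ℕ n → ℕ} → PR n t → PR n a → PR n b →
               PRᵇ n (λ v → does (anyUpTo? (λ u → Q? u (a v) (b v)) (t v)))
  anyUpTo-PR Q? QP = comp₃ anyχ anyUpTo₃
    where
    anyχ : ℕ → ℕ → ℕ → ℕ
    anyχ t y z = χ (does (anyUpTo? (λ u → Q? u y z) t))
    anyUpTo₃ : PR₃ anyχ
    anyUpTo₃ =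
      primrec₃ anyχ (λ _ _ → 0) (λ t r y z → χ (does (Q? t y z)) ⊔ r) (const 0)
               (comp₂ _⊔_ pr-max (comp₃ (λ u y z → χ (does (Q? u y z))) QP x₀ x₂ x₃) x₁)
               (λ _ _ → refl)
               (λ t y z → trans (cong χ (anyUpTo?-suc (λ u → Q? u y z) t))
                                 (χ-∨ (does (Q? t y z)) (does (anyUpTo? (λ u → Q? u y z) t))))

  divisor≤-PR : ∀ {n} {d s : Vec ℕ n → ℕ} → PR n d → PR n s →
                PRᵇ n (λ v → does (divisor≤? (d v) (s v)))
  divisor≤-PR D S = anyUpTo-PR (λ q d s → q * d ≟ s) (≡ᵇ-PR (x₀ *ᴾ x₁) x₂) (sucᴾ S) D S

  prime-PR : ∀ {n} {s : Vec ℕ n → ℕ} → PR n s → PRᵇ n (λ v → does (prime? (s v)))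
  prime-PR {s = s} S =
    pr-ext (∧-PR (≤ᵇ-PR (const 2) S) (not-PR hasFactor)) (λ v → cong χ (primeTest?≡prime? (s v)))
    where
    hasFactor = anyUpTo-PR (λ d s _ → 2 ≤? d ×-dec divisor≤? d s)
                           (∧-PR (≤ᵇ-PR (const 2) x₀) (divisor≤-PR x₀ x₁)) S S S

  -- search s k is the first prime in [s, s + k), or s + k if there is none.
  search-suc : ∀ s k → search s (suc k) ≡
               (if suc (search s k) ≤ᵇ s + k then search s k
                else if does (prime? (s + k)) then s + k else suc (s + k))
  search-suc s zero rewrite +-identityʳ s | dec-false (suc s ≤? s) (n≮n s) with does (prime? s)
  ... | true  = refl
  ... | false = refl
  search-suc s (suc k) with does (prime? s)
  ... | true  rewrite dec-true (suc s ≤? s + suc k) (m<m+n s z<s) = refl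
  ... | false rewrite +-suc s k = search-suc (suc s) k

  search-PR : PR₂ search
  search-PR = flip-PR (λ k s → search s k)
    (primrec₂ (λ k s → search s k) (λ s → s) step x₀ step-PR (λ _ → refl) (λ k s → search-suc s k))
    where
    step : ℕ → ℕ → ℕ → ℕ
    step k r s = if suc r ≤ᵇ s + k then r else if does (prime? (s + k)) then s + k else suc (s + k)
    step-PR : PR₃ step
    step-PR = if-PR (≤ᵇ-PR (sucᴾ x₁) (x₂ +ᴾ x₀)) x₁
                    (if-PR (prime-PR (x₂ +ᴾ x₀)) (x₂ +ᴾ x₀) (sucᴾ (x₂ +ᴾ x₀)))

  P-PR : PR₁ P
  P-PR = primrec₁ P (λ _ p → search (suc p) (p !))
                  (comp₂ search search-PR (sucᴾ x₁) (comp₁ _! !-PR x₁)) (λ _ → refl)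

  gfun-PR : PR₁ gfun
  gfun-PR = primrec₁ gfun (λ j r → P j ^ (2 * (j + 2) * (r + 1) ^ 3))
                     (comp₁ P P-PR x₀ ^ᴾ (const 2 *ᴾ (x₀ +ᴾ const 2) *ᴾ (x₁ +ᴾ const 1) ^ᴾ const 3))
                     (λ _ → refl)

  elementary⇒PR : ∀ {n f} → Elementary n f → PR n f
  allElementary⇒PR : ∀ {n m} {hs : Vec (Vec ℕ n → ℕ) m} → AllEl hs → AllPR ψ hs
  elementary⇒PR el-exp               = pr-exp
  elementary⇒PR el-max               = pr-max
  elementary⇒PR el-zero              = pr-zero
  elementary⇒PR el-suc               = pr-suc
  elementary⇒PR (el-proj i)          = pr-proj i
  elementary⇒PR (el-comp e es)       = pr-comp (elementary⇒PR e) (allElementary⇒PR es)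
  elementary⇒PR (el-brec e₁ e₂ _ _)  = pr-rec (elementary⇒PR e₁) (elementary⇒PR e₂)
  elementary⇒PR (el-ext e f≗f')      = pr-ext (elementary⇒PR e) f≗f'
  allElementary⇒PR []       = []
  allElementary⇒PR (e ∷ es) = elementary⇒PR e ∷ allElementary⇒PR es

  graphχ≡χ : ∀ f x y → graphχ f (x ∷ y ∷ []) ≡ χ (f x ≡ᵇ y)
  graphχ≡χ f x y with does (f x ≟ y)
  ... | true  = refl
  ... | false = refl

  valueBelow : (ℕ → ℕ) → ℕ → ℕ → ℕ
  valueBelow f zero    x = 0
  valueBelow f (suc t) x = if f x ≡ᵇ t then t else valueBelow f t x

  valueBelow-correct : ∀ f {x t} → f x < t → valueBelow f t x ≡ f x
  valueBelow-correct f {x} {suc t} fx<1+t with f x ≟ t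
  ... | yes fx≡t rewrite dec-true (f x ≟ t) fx≡t = sym fx≡t
  ... | no  fx≢t rewrite dec-false (f x ≟ t) fx≢t = valueBelow-correct f (≤∧≢⇒< (s≤s⁻¹ fx<1+t) fx≢t)

  αden-bounded⇒PR : (f : ℕ → ℕ) → Elementary 2 (graphχ f) → (B : ℕ → ℕ) → PR₁ B →
                    (∀ i → f i < B (αden f i)) → PR₁ f
  αden-bounded⇒PR f graph B B-PR f<B =
    pr-ext (comp₂ value value-PR x₀ (comp₁ (αden f) αden-PR x₀)) (λ { (i ∷ []) → value-αden i })
    where
    graph-PR : PRᵇ 2 (λ v → f (lookup v Fin.zero) ≡ᵇ lookup v (Fin.suc Fin.zero))
    graph-PR = pr-ext (elementary⇒PR graph) (λ { (x ∷ y ∷ []) → graphχ≡χ f x y })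

    valueBelow-PR : PR₂ (valueBelow f)
    valueBelow-PR = primrec₂ (valueBelow f) (λ _ → 0) (λ t r x → if f x ≡ᵇ t then t else r) (const 0)
                             (if-PR (pr-comp graph-PR (x₂ ∷ x₀ ∷ [])) x₀ x₁) (λ _ → refl) (λ _ _ → refl)

    value : ℕ → ℕ → ℕ
    value i q = valueBelow f (B q) i

    value-PR : PR₂ value
    value-PR = comp₂ (valueBelow f) valueBelow-PR (comp₁ B B-PR x₁) x₀

    value-αden : ∀ i → value i (αden f i) ≡ f i
    value-αden i = valueBelow-correct f (f<B i)

    αden-PR : PR₁ (αden f)
    αden-PR = primrec₁ (αden f) (λ i r → r * P i ^ gfun (value i r + i))
                       (x₁ *ᴾ comp₁ P P-PR x₀ ^ᴾ comp₁ gfun gfun-PR (comp₂ value value-PR x₀ x₁ +ᴾ x₀))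
                       (λ i → cong (λ y → αden f i * P i ^ gfun (y + i)) (sym (value-αden i)))

module Growth where

  open import Data.Nat
  open import Data.Nat.Properties
  open import Data.Nat.Tactic.RingSolver using (solve-∀)
  open import Data.Sum using (inj₁; inj₂)
  open import Relation.Binary.PropositionalEquality
  open ≤-Reasoning

  step-mono : (a : ℕ → ℕ) → (∀ n → a n ≤ a (suc n)) → ∀ {m n} → m ≤ n → a m ≤ a n
  step-mono a step {n = zero}  z≤n    = ≤-refl
  step-mono a step {m} {suc n} m≤1+n with m≤n⇒m<n∨m≡n m≤1+n
  ... | inj₁ m<1+n = ≤-trans (step-mono a step (s≤s⁻¹ m<1+n)) (step n)
  ... | inj₂ refl  = ≤-refl

  step-strict : (a : ℕ → ℕ) → (∀ n → a n < a (suc n)) → ∀ {m n} → m < n → a m < a n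
  step-strict a step {m} m<n = <-≤-trans (step m) (step-mono a (λ k → <⇒≤ (step k)) m<n)

  n<m^n : ∀ {m} → 1 < m → ∀ n → n < m ^ n
  n<m^n 1<m zero    = z<s
  n<m^n {m} 1<m (suc n) = begin-strict
    suc n         ≤⟨ n<m^n 1<m n ⟩
    m ^ n         ≡⟨ *-identityˡ (m ^ n) ⟨
    1 * m ^ n     <⟨ *-monoˡ-< (m ^ n) {{m^n≢0 m n {{>-nonZero (<-trans z<s 1<m)}}}} 1<m ⟩
    m * m ^ n     ∎

  P-< : ∀ i → P i < P (suc i)
  P-< i = search-≥ (suc (P i)) (P i !)

  P-mono : ∀ {i j} → i ≤ j → P i ≤ P j
  P-mono = step-mono P (λ i → <⇒≤ (P-< i))

  P≥2 : ∀ i → 2 ≤ P i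
  P≥2 i = P-mono {0} {i} z≤n

  gfun-< : ∀ j → gfun j < gfun (suc j)
  gfun-< j = begin-strict
    gfun j                          <⟨ m<m+n (gfun j) z<s ⟩
    gfun j + 1                      ≤⟨ m≤m*n (gfun j + 1) ((gfun j + 1) ^ 2) {{t²≢0}} ⟩
    (gfun j + 1) ^ 3                ≤⟨ m≤n*m ((gfun j + 1) ^ 3) (2 * (j + 2)) {{2[j+2]≢0}} ⟩
    2 * (j + 2) * (gfun j + 1) ^ 3  <⟨ n<m^n (P≥2 j) _ ⟩
    gfun (suc j)                    ∎
    where
    instance
      t²≢0 : NonZero ((gfun j + 1) ^ 2)
      t²≢0 = m^n≢0 (gfun j + 1) 2 {{subst NonZero (+-comm 1 (gfun j)) _}}
      2[j+2]≢0 : NonZero (2 * (j + 2))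
      2[j+2]≢0 = subst (λ k → NonZero (2 * k)) (+-comm 2 j) _

  gfun-mono : ∀ {i j} → i ≤ j → gfun i ≤ gfun j
  gfun-mono = step-mono gfun (λ j → <⇒≤ (gfun-< j))

  gfun-strict : ∀ {i j} → i < j → gfun i < gfun j
  gfun-strict = step-strict gfun gfun-<

  j<gfun : ∀ j → j < gfun j
  j<gfun zero    = z<s
  j<gfun (suc j) = <-≤-trans (s≤s (j<gfun j)) (gfun-< j)

  exponent-≤ : ∀ {i g F} k → 1 ≤ g → i ≤ g → F ≤ g + 1 →
               2 + (1 + i * g) * F ≤ 2 * (k + 2) * (g + 1) ^ 3
  exponent-≤ {i} {g} {F} k 1≤g i≤g F≤t = begin
    2 + (1 + i * g) * F   ≤⟨ +-mono-≤ 2≤t³ (*-mono-≤ 1+ig≤t² F≤t) ⟩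
    t ^ 3 + t ^ 2 * t     ≡⟨ twice g ⟩
    2 * t ^ 3             ≤⟨ *-monoˡ-≤ (t ^ 3) (m≤m*n 2 (k + 2) {{k+2≢0}}) ⟩
    2 * (k + 2) * t ^ 3   ∎
    where
    t = g + 1
    -- stated without _^_, which the ring solver does not support
    square : ∀ x → (x + 1) * ((x + 1) * 1) ≡ 1 + x * x + 2 * x
    square = solve-∀
    twice : ∀ x → let c = (x + 1) * ((x + 1) * ((x + 1) * 1)) in
            c + (x + 1) * ((x + 1) * 1) * (x + 1) ≡ 2 * c
    twice = solve-∀
    instance
      k+2≢0 : NonZero (k + 2)
      k+2≢0 = subst NonZero (+-comm 2 k) _
      t≢0 : NonZero t
      t≢0 = subst NonZero (+-comm 1 g) _
    1+ig≤t² : 1 + i * g ≤ t ^ 2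
    1+ig≤t² = begin
      1 + i * g          ≤⟨ +-monoʳ-≤ 1 (*-monoˡ-≤ g i≤g) ⟩
      1 + g * g          ≤⟨ m≤m+n (1 + g * g) (2 * g) ⟩
      1 + g * g + 2 * g  ≡⟨ square g ⟨
      t ^ 2              ∎
    2≤t³ : 2 ≤ t ^ 3
    2≤t³ = begin
      2      ≤⟨ +-monoˡ-≤ 1 1≤g ⟩
      t      ≤⟨ m≤m*n t (t ^ 2) {{m^n≢0 t 2}} ⟩
      t ^ 3  ∎

  hfun-< : ∀ f → (∀ x → f x ≤ f (suc x)) → ∀ n → hfun f n < hfun f (suc n)
  hfun-< f f-step n = gfun-strict (+-mono-≤-< (f-step n) (n<1+n n))

  module Increasing (f : ℕ → ℕ) (f-step : ∀ x → f x ≤ f (suc x)) (f≥1 : ∀ x → 1 ≤ f x) where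

    αden-≤ : ∀ {i j} → f i + i ≤ suc j → αden f i ≤ P j ^ (i * gfun j)
    αden-≤ {zero}      _     = ≤-refl
    αden-≤ {suc i} {j} bound = begin
      αden f i * P i ^ hfun f i  ≤⟨ *-mono-≤ (αden-≤ (≤-trans (<⇒≤ step) bound)) Pᵢʰ≤Pⱼᵍ ⟩
      P j ^ (i * g) * P j ^ g    ≡⟨ ^-distribˡ-+-* (P j) (i * g) g ⟨
      P j ^ (i * g + g)          ≡⟨ cong (P j ^_) (+-comm (i * g) g) ⟩
      P j ^ (suc i * g)          ∎
      where
      g = gfun j
      step : f i + i < f (suc i) + suc i
      step = +-mono-≤-< (f-step i) (n<1+n i)
      fi+i≤j : f i + i ≤ j
      fi+i≤j = s≤s⁻¹ (≤-trans step bound)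
      Pᵢʰ≤Pⱼᵍ : P i ^ hfun f i ≤ P j ^ g
      Pᵢʰ≤Pⱼᵍ = ≤-trans (^-monoˡ-≤ (hfun f i) (P-mono (≤-trans (m≤n+m i (f i)) fi+i≤j)))
                        (^-monoʳ-≤ (P j) {{P-nz j}} (gfun-mono fi+i≤j))

    αden-growth : ∀ i → 3 * (2 * αden f i) ^ f i ≤ 2 ^ hfun f i
    αden-growth i = go (cong (_+ i) (sym (suc-pred (f i) {{>-nonZero (f≥1 i)}})))
      where
      go : ∀ {j} → f i + i ≡ suc j → 3 * (2 * αden f i) ^ f i ≤ 2 ^ hfun f i
      go {j} eq = begin
        3 * (2 * αden f i) ^ F         ≤⟨ *-mono-≤ 3≤p² (^-monoˡ-≤ F 2Q≤p*pⁱᵍ) ⟩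
        p ^ 2 * (p * p ^ (i * g)) ^ F  ≡⟨ cong (p ^ 2 *_) (^-*-assoc p (1 + i * g) F) ⟩
        p ^ 2 * p ^ ((1 + i * g) * F)  ≡⟨ ^-distribˡ-+-* p 2 ((1 + i * g) * F) ⟨
        p ^ (2 + (1 + i * g) * F)      ≤⟨ ^-monoʳ-≤ p {{P-nz j}} (exponent-≤ j 1≤g i≤g F≤g+1) ⟩
        gfun (suc j)                   ≡⟨ cong gfun eq ⟨
        hfun f i                       <⟨ n<m^n ≤-refl (hfun f i) ⟩
        2 ^ hfun f i                   ∎
        where
        F = f i
        p = P j
        g = gfun j
        2Q≤p*pⁱᵍ : 2 * αden f i ≤ p * p ^ (i * g)
        2Q≤p*pⁱᵍ = *-mono-≤ (P≥2 j) (αden-≤ (≤-reflexive eq))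
        3≤p² : 3 ≤ p ^ 2
        3≤p² = ≤-trans (n≤1+n 3) (*-mono-≤ (P≥2 j) (*-mono-≤ (P≥2 j) ≤-refl))
        i≤j : i ≤ j
        i≤j = s≤s⁻¹ (≤-trans (+-monoˡ-≤ i (f≥1 i)) (≤-reflexive eq))
        i≤g : i ≤ g
        i≤g = ≤-trans i≤j (<⇒≤ (j<gfun j))
        1≤g : 1 ≤ g
        1≤g = ≤-trans (s≤s z≤n) (j<gfun j)
        F≤g+1 : F ≤ g + 1
        F≤g+1 = ≤-trans (m≤m+n F i) (≤-trans (≤-reflexive eq) (≤-trans (j<gfun j) (m≤m+n g 1)))

module Fractions where

  open import Data.Nat as ℕ using (ℕ; suc; NonZero)
  import Data.Nat.Properties as ℕP
  open import Data.Nat.Divisibility using (∣⇒≤)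
  open import Data.Nat.GCD using (gcd; gcd[m,n]∣m)
  open import Data.Integer as ℤ using (+_)
  import Data.Integer.Properties as ℤP
  open import Data.Rational as ℚ using (ℚ; _/_; toℚᵘ; 0ℚ)
  import Data.Rational.Properties as ℚP
  open import Data.Rational.Unnormalised as ℚᵘ using (mkℚᵘ; *≡*; *≤*; *<*)
  import Data.Rational.Unnormalised.Properties as ℚᵘP
  open import Data.Nat.Tactic.RingSolver using (solve-∀)
  open import Relation.Binary.PropositionalEquality

  toℚᵘ-/ : ∀ a B .{{_ : NonZero B}} → toℚᵘ ((+ a) / B) ℚᵘ.≃ mkℚᵘ (+ a) (ℕ.pred B)
  toℚᵘ-/ a (suc b) = ℚP.toℚᵘ-fromℚᵘ (mkℚᵘ (+ a) b)

  cross-≡⇒/≡ : ∀ a c B C .{{_ : NonZero B}} .{{_ : NonZero C}} →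
               a ℕ.* C ≡ c ℕ.* B → (+ a) / B ≡ (+ c) / C
  cross-≡⇒/≡ a c B@(suc _) C@(suc _) eq = ℚP.toℚᵘ-injective
    (ℚᵘP.≃-trans (toℚᵘ-/ a B) (ℚᵘP.≃-trans cross (ℚᵘP.≃-sym (toℚᵘ-/ c C))))
    where
    cross : mkℚᵘ (+ a) (ℕ.pred B) ℚᵘ.≃ mkℚᵘ (+ c) (ℕ.pred C)
    cross = *≡* (trans (sym (ℤP.pos-* a C)) (trans (cong +_ eq) (ℤP.pos-* c B)))

  cross-≤⇒/≤ : ∀ a c B C .{{_ : NonZero B}} .{{_ : NonZero C}} →
               a ℕ.* C ℕ.≤ c ℕ.* B → (+ a) / B ℚ.≤ (+ c) / C
  cross-≤⇒/≤ a c B@(suc _) C@(suc _) le = ℚP.toℚᵘ-cancel-≤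
    (ℚᵘP.≤-respˡ-≃ (ℚᵘP.≃-sym (toℚᵘ-/ a B)) (ℚᵘP.≤-respʳ-≃ (ℚᵘP.≃-sym (toℚᵘ-/ c C))
      (*≤* (subst₂ ℤ._≤_ (ℤP.pos-* a C) (ℤP.pos-* c B) (ℤ.+≤+ le)))))

  cross-<⇒/< : ∀ a c B C .{{_ : NonZero B}} .{{_ : NonZero C}} →
               a ℕ.* C ℕ.< c ℕ.* B → (+ a) / B ℚ.< (+ c) / C
  cross-<⇒/< a c B@(suc _) C@(suc _) lt = ℚP.toℚᵘ-cancel-<
    (ℚᵘP.<-respˡ-≃ (ℚᵘP.≃-sym (toℚᵘ-/ a B)) (ℚᵘP.<-respʳ-≃ (ℚᵘP.≃-sym (toℚᵘ-/ c C))
      (*<* (subst₂ ℤ._<_ (ℤP.pos-* a C) (ℤP.pos-* c B) (ℤ.+<+ lt)))))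

  /<⇒cross-< : ∀ a c B C .{{_ : NonZero B}} .{{_ : NonZero C}} →
               (+ a) / B ℚ.< (+ c) / C → a ℕ.* C ℕ.< c ℕ.* B
  /<⇒cross-< a c B@(suc _) C@(suc _) lt
    with ℚᵘP.<-respˡ-≃ (toℚᵘ-/ a B) (ℚᵘP.<-respʳ-≃ (toℚᵘ-/ c C) (ℚP.toℚᵘ-mono-< lt))
  ... | *<* aC<cB with subst₂ ℤ._<_ (sym (ℤP.pos-* a C)) (sym (ℤP.pos-* c B)) aC<cB
  ...   | ℤ.+<+ lt′ = lt′

  /+/ : ∀ a c B C .{{_ : NonZero B}} .{{_ : NonZero C}} →
        (+ a) / B ℚ.+ (+ c) / C ≡ _/_ (+ (a ℕ.* C ℕ.+ c ℕ.* B)) (B ℕ.* C) {{ℕP.m*n≢0 B C}}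
  /+/ a c B@(suc _) C@(suc _) = ℚP.toℚᵘ-injective
    (ℚᵘP.≃-trans (ℚP.toℚᵘ-homo-+ ((+ a) / B) ((+ c) / C))
    (ℚᵘP.≃-trans (ℚᵘP.+-cong (toℚᵘ-/ a B) (toℚᵘ-/ c C))
    (ℚᵘP.≃-trans (ℚᵘP.≃-reflexive (cong (λ z → mkℚᵘ z _) numerator))
                 (ℚᵘP.≃-sym (toℚᵘ-/ _ (B ℕ.* C))))))
    where
    numerator : (+ a) ℤ.* (+ C) ℤ.+ (+ c) ℤ.* (+ B) ≡ + (a ℕ.* C ℕ.+ c ℕ.* B)
    numerator = trans (cong₂ ℤ._+_ (sym (ℤP.pos-* a C)) (sym (ℤP.pos-* c B)))
                      (sym (ℤP.pos-+ (a ℕ.* C) (c ℕ.* B)))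

  /+/-same : ∀ a c B .{{_ : NonZero B}} → (+ a) / B ℚ.+ (+ c) / B ≡ (+ (a ℕ.+ c)) / B
  /+/-same a c B = trans (/+/ a c B B)
    (cross-≡⇒/≡ (a ℕ.* B ℕ.+ c ℕ.* B) (a ℕ.+ c) (B ℕ.* B) B {{ℕP.m*n≢0 B B}} (distrib a c B))
    where
    distrib : ∀ a c B → (a ℕ.* B ℕ.+ c ℕ.* B) ℕ.* B ≡ (a ℕ.+ c) ℕ.* (B ℕ.* B)
    distrib = solve-∀

  /+1/ : ∀ a B .{{_ : NonZero B}} → (+ a) / B ℚ.+ (+ 1) / B ≡ (+ suc a) / B
  /+1/ a B = trans (/+/-same a 1 B) (cong (λ m → (+ m) / B) (ℕP.+-comm a 1))

  0≤/ : ∀ a B .{{_ : NonZero B}} → 0ℚ ℚ.≤ (+ a) / B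
  0≤/ a B = cross-≤⇒/≤ 0 a 1 B ℕ.z≤n

  /<-same⇒< : ∀ a c B .{{_ : NonZero B}} → (+ a) / B ℚ.< (+ c) / B → a ℕ.< c
  /<-same⇒< a c B lt = ℕP.*-cancelʳ-< B a c (/<⇒cross-< a c B B lt)

  p≤p+q : ∀ p {q} → 0ℚ ℚ.≤ q → p ℚ.≤ p ℚ.+ q
  p≤p+q p {q} 0≤q = subst (ℚ._≤ p ℚ.+ q) (ℚP.+-identityʳ p) (ℚP.+-monoʳ-≤ p 0≤q)

  0<1/ : ∀ B .{{_ : NonZero B}} → 0ℚ ℚ.< (+ 1) / B
  0<1/ B = cross-<⇒/< 0 1 1 B (ℕ.s≤s ℕ.z≤n)

  ≤denominator* : ∀ d B .{{_ : NonZero B}} → 1 ℕ.≤ d → B ℕ.≤ ℚ.denominatorℕ ((+ d) / B) ℕ.* d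
  ≤denominator* d B 1≤d = subst (ℕ._≤ den ℕ.* d) den*gcd≡B
    (ℕP.*-monoʳ-≤ den (∣⇒≤ {{ℕ.>-nonZero 1≤d}} (gcd[m,n]∣m d B)))
    where
    den = ℚ.denominatorℕ ((+ d) / B)
    den*gcd≡B : den ℕ.* gcd d B ≡ B
    den*gcd≡B = ℤP.+-injective (trans (ℤP.pos-* den (gcd d B)) (ℚP.↧-/ (+ d) B))

module Limits where

  open import Data.Nat as ℕ using (ℕ)
  import Data.Nat.Properties as ℕP
  open import Data.Rational using (ℚ; _+_; _-_; -_; _≤_; _<_; ∣_∣; 0ℚ)
  open import Data.Rational.Properties
  open import Data.Rational.Solver using (module +-*-Solver)
  open import Data.Product using (_,_)
  open import Data.Sum using (inj₁; inj₂)
  open import Relation.Binary.PropositionalEquality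
  open +-*-Solver

  p≤∣p∣ : ∀ p → p ≤ ∣ p ∣
  p≤∣p∣ p with ∣p∣≡p∨∣p∣≡-p p
  ... | inj₁ ∣p∣≡p  = ≤-reflexive (sym ∣p∣≡p)
  ... | inj₂ ∣p∣≡-p = ≤-trans p≤0 (0≤∣p∣ p)
    where
    p≤0 : p ≤ 0ℚ
    p≤0 = subst (_≤ 0ℚ) (solve 1 (λ p → :- (:- p) := p) refl p)
                (neg-antimono-≤ (subst (0ℚ ≤_) ∣p∣≡-p (0≤∣p∣ p)))

  ∣p-q∣≡∣q-p∣ : ∀ p q → ∣ p - q ∣ ≡ ∣ q - p ∣
  ∣p-q∣≡∣q-p∣ p q =
    trans (sym (∣-p∣≡∣p∣ (p - q))) (cong ∣_∣ (solve 2 (λ p q → :- (p :- q) := q :- p) refl p q))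

  +-cancelʳ-< : ∀ {a b} p → a + p < b + p → a < b
  +-cancelʳ-< {a} {b} p lt = subst₂ _<_ (cancel a p) (cancel b p) (+-monoˡ-< (- p) lt)
    where
    cancel : ∀ x p → (x + p) - p ≡ x
    cancel = solve 2 (λ x p → (x :+ p) :- p := x) refl

  SameLimit-sym : ∀ {s t} → SameLimit s t → SameLimit t s
  SameLimit-sym {s} {t} close ε ε>0 with close ε ε>0
  ... | N , near = N , λ m n N≤m N≤n → subst (_< ε) (∣p-q∣≡∣q-p∣ (s n) (t m)) (near n m N≤n N≤m)

  limit-gap : ∀ {s t a c ε} j l → SameLimit s t → 0ℚ < ε →
              (∀ m → a ≤ s (j ℕ.+ m)) → (∀ n → t (l ℕ.+ n) ≤ c) → a < c + ε
  limit-gap {s} {t} {a} {c} {ε} j l close ε>0 s≥a t≤c with close ε ε>0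
  ... | N , near = begin-strict
    a                      ≤⟨ s≥a N ⟩
    x                      ≡⟨ solve 2 (λ x y → x := (x :- y) :+ y) refl x y ⟩
    (x - y) + y            <⟨ +-monoˡ-< y (≤-<-trans (p≤∣p∣ (x - y)) x-y<ε) ⟩
    ε + y                  ≤⟨ +-monoʳ-≤ ε (t≤c N) ⟩
    ε + c                  ≡⟨ +-comm ε c ⟩
    c + ε                  ∎
    where
    open ≤-Reasoning
    x = s (j ℕ.+ N)
    y = t (l ℕ.+ N)
    x-y<ε : ∣ x - y ∣ < ε
    x-y<ε = near (j ℕ.+ N) (l ℕ.+ N) (ℕP.m≤n+m N j) (ℕP.m≤n+m N l)

module AlphaBounds where

  open Growth using (P≥2; hfun-<)
  open Fractions
  open import Data.Nat as ℕ using (ℕ; zero; suc; NonZero; _^_)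
  import Data.Nat.Properties as ℕP
  open import Data.Nat.Tactic.RingSolver using (solve-∀)
  open import Data.Integer using (+_)
  open import Data.Rational using (ℚ; _/_; _+_; _≤_; 0ℚ)
  open import Data.Rational.Properties
  open import Data.Product using (∃; _,_)
  open import Relation.Binary.PropositionalEquality

  -- αprefix f i = Σ_{j<i} P_j^{-h(j)} = α^f_{i-1}
  αprefix : (ℕ → ℕ) → ℕ → ℚ
  αprefix f zero    = 0ℚ
  αprefix f (suc n) = αseq f n

  αseq≡αprefix+Pinv : ∀ f n → αseq f n ≡ αprefix f n + Pinv n (hfun f n)
  αseq≡αprefix+Pinv f zero    = sym (+-identityˡ _)
  αseq≡αprefix+Pinv f (suc n) = refl

  αden-nonZero : ∀ f i → NonZero (αden f i)
  αden-nonZero f zero    = _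
  αden-nonZero f (suc i) =
    ℕP.m*n≢0 (αden f i) (P i ^ hfun f i) {{αden-nonZero f i}} {{ℕP.m^n≢0 (P i) (hfun f i) {{P-nz i}}}}

  αprefix-/ : ∀ f i → ∃ λ M → αprefix f i ≡ _/_ (+ M) (αden f i) {{αden-nonZero f i}}
  αprefix-/ f zero    = 0 , refl
  αprefix-/ f (suc i) with αprefix-/ f i
  ... | M , eq = M ℕ.* P i ^ hfun f i ℕ.+ 1 ℕ.* αden f i ,
      (begin
        αseq f i                                     ≡⟨ αseq≡αprefix+Pinv f i ⟩
        αprefix f i + Pinv i (hfun f i)              ≡⟨ cong (_+ Pinv i (hfun f i)) eq ⟩
        _/_ (+ M) (αden f i) {{αden-nonZero f i}} + Pinv i (hfun f i)
          ≡⟨ /+/ M 1 (αden f i) (P i ^ hfun f i) {{αden-nonZero f i}} {{ℕP.m^n≢0 (P i) (hfun f i) {{P-nz i}}}} ⟩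
        _/_ (+ (M ℕ.* P i ^ hfun f i ℕ.+ 1 ℕ.* αden f i)) (αden f (suc i)) {{αden-nonZero f (suc i)}} ∎)
    where open ≡-Reasoning

  ½^ : ℕ → ℚ
  ½^ a = (+ 1) / 2 ^ a
    where instance _ = ℕP.m^n≢0 2 a

  0≤Pinv : ∀ i e → 0ℚ ≤ Pinv i e
  0≤Pinv i e = 0≤/ 1 (P i ^ e) {{ℕP.m^n≢0 (P i) e {{P-nz i}}}}

  0≤½^ : ∀ a → 0ℚ ≤ ½^ a
  0≤½^ a = 0≤/ 1 (2 ^ a) {{ℕP.m^n≢0 2 a}}

  Pinv≤½^ : ∀ i e → Pinv i e ≤ ½^ e
  Pinv≤½^ i e = cross-≤⇒/≤ 1 1 (P i ^ e) (2 ^ e) {{ℕP.m^n≢0 (P i) e {{P-nz i}}}} {{ℕP.m^n≢0 2 e}}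
    (ℕP.*-monoʳ-≤ 1 (ℕP.^-monoˡ-≤ e (P≥2 i)))

  ½^-anti : ∀ {a b} → a ℕ.≤ b → ½^ b ≤ ½^ a
  ½^-anti {a} {b} a≤b = cross-≤⇒/≤ 1 1 (2 ^ b) (2 ^ a) {{ℕP.m^n≢0 2 b}} {{ℕP.m^n≢0 2 a}}
    (ℕP.*-monoʳ-≤ 1 (ℕP.^-monoʳ-≤ 2 a≤b))

  ½^-suc-double : ∀ a → ½^ (suc a) + ½^ (suc a) ≡ ½^ a
  ½^-suc-double a = trans (/+/-same 1 1 (2 ^ suc a) {{ℕP.m^n≢0 2 (suc a)}})
    (cross-≡⇒/≡ 2 1 (2 ^ suc a) (2 ^ a) {{ℕP.m^n≢0 2 (suc a)}} {{ℕP.m^n≢0 2 a}} (double (2 ^ a)))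
    where
    double : ∀ x → 2 ℕ.* x ≡ 1 ℕ.* (2 ℕ.* x)
    double = solve-∀

  αseq-≥ : ∀ f i d → αprefix f i + Pinv i (hfun f i) ≤ αseq f (i ℕ.+ d)
  αseq-≥ f i zero rewrite ℕP.+-identityʳ i = ≤-reflexive (sym (αseq≡αprefix+Pinv f i))
  αseq-≥ f i (suc d) rewrite ℕP.+-suc i d =
    ≤-trans (αseq-≥ f i d) (p≤p+q (αseq f (i ℕ.+ d)) (0≤Pinv (suc (i ℕ.+ d)) (hfun f (suc (i ℕ.+ d)))))

  αseq-tail : ∀ f → (∀ x → f x ℕ.≤ f (suc x)) → ∀ i d →
              αseq f (i ℕ.+ d) + ½^ (hfun f (i ℕ.+ d)) ≤ αprefix f i + (½^ (hfun f i) + ½^ (hfun f i))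
  αseq-tail f f-step i zero rewrite ℕP.+-identityʳ i = begin
    αseq f i + e                           ≡⟨ cong (_+ e) (αseq≡αprefix+Pinv f i) ⟩
    (αprefix f i + Pinv i (hfun f i)) + e  ≤⟨ +-monoˡ-≤ e (+-monoʳ-≤ (αprefix f i) (Pinv≤½^ i (hfun f i))) ⟩
    (αprefix f i + e) + e                  ≡⟨ +-assoc (αprefix f i) e e ⟩
    αprefix f i + (e + e)                  ∎
    where
    open ≤-Reasoning
    e = ½^ (hfun f i)
  αseq-tail f f-step i (suc d) rewrite ℕP.+-suc i d = begin
    (αseq f n + Pinv (suc n) h′) + ½^ h′   ≤⟨ +-monoˡ-≤ (½^ h′) (+-monoʳ-≤ (αseq f n) (Pinv≤½^ (suc n) h′)) ⟩
    (αseq f n + ½^ h′) + ½^ h′             ≡⟨ +-assoc (αseq f n) (½^ h′) (½^ h′) ⟩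
    αseq f n + (½^ h′ + ½^ h′)             ≤⟨ +-monoʳ-≤ (αseq f n) (+-mono-≤ (½^-anti h<h′) (½^-anti h<h′)) ⟩
    αseq f n + (½^ (suc h) + ½^ (suc h))   ≡⟨ cong (λ x → αseq f n + x) (½^-suc-double h) ⟩
    αseq f n + ½^ h                        ≤⟨ αseq-tail f f-step i d ⟩
    αprefix f i + (½^ (hfun f i) + ½^ (hfun f i)) ∎
    where
    open ≤-Reasoning
    n = i ℕ.+ d
    h = hfun f n
    h′ = hfun f (suc n)
    h<h′ : suc h ℕ.≤ h′
    h<h′ = hfun-< f f-step n

  αseq-≤ : ∀ f → (∀ x → f x ℕ.≤ f (suc x)) → ∀ i d →
           αseq f (i ℕ.+ d) ≤ αprefix f i + (½^ (hfun f i) + ½^ (hfun f i))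
  αseq-≤ f f-step i d =
    ≤-trans (p≤p+q (αseq f (i ℕ.+ d)) (0≤½^ (hfun f (i ℕ.+ d)))) (αseq-tail f f-step i d)

module Expansion (c : ℕ) (D k : ℕ → ℕ)
                 (digit< : ∀ i → D (suc i) ℕ.< suc (suc c)) (k-< : ∀ i → k i ℕ.< k (suc i)) where

  open Fractions
  import Data.Nat.Properties as ℕP
  open import Data.Rational using (_+_; _≤_; 0ℚ)
  open import Data.Rational.Properties
  open import Relation.Binary.PropositionalEquality

  b : ℕ
  b = suc (suc c)

  bᵉ≢0 : ∀ e → ℕ.NonZero (b ℕ.^ e)
  bᵉ≢0 e = ℕP.m^n≢0 b e

  0≤digitTerm : ∀ d e → 0ℚ ≤ digitTerm c d e
  0≤digitTerm d e = 0≤/ d (b ℕ.^ e) {{bᵉ≢0 e}}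

  digit+unit≤unit : ∀ m → digitTerm c (D (suc m)) (k (suc m)) + digitTerm c 1 (k (suc m)) ≤ digitTerm c 1 (k m)
  digit+unit≤unit m = subst (_≤ digitTerm c 1 (k m)) (sym (/+/-same d 1 B {{bᵉ≢0 (k (suc m))}}))
    (cross-≤⇒/≤ (d ℕ.+ 1) 1 B (b ℕ.^ k m) {{bᵉ≢0 (k (suc m))}} {{bᵉ≢0 (k m)}} (begin
      (d ℕ.+ 1) ℕ.* b ℕ.^ k m   ≤⟨ ℕP.*-monoˡ-≤ (b ℕ.^ k m) (subst (ℕ._≤ b) (ℕP.+-comm 1 d) (digit< m)) ⟩
      b ℕ.^ suc (k m)           ≤⟨ ℕP.^-monoʳ-≤ b (k-< m) ⟩
      B                         ≡⟨ ℕP.*-identityˡ B ⟨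
      1 ℕ.* B                   ∎))
    where
    open ℕP.≤-Reasoning
    d = D (suc m)
    B = b ℕ.^ k (suc m)

  partialSum-tail : ∀ j d → partialSum c D k (j ℕ.+ d) + digitTerm c 1 (k (j ℕ.+ d))
                            ≤ partialSum c D k j + digitTerm c 1 (k j)
  partialSum-tail j zero rewrite ℕP.+-identityʳ j = ≤-refl
  partialSum-tail j (suc d) rewrite ℕP.+-suc j d = begin
    (x n + digitTerm c (D (suc n)) (k (suc n))) + digitTerm c 1 (k (suc n))
      ≡⟨ +-assoc (x n) _ _ ⟩
    x n + (digitTerm c (D (suc n)) (k (suc n)) + digitTerm c 1 (k (suc n)))
      ≤⟨ +-monoʳ-≤ (x n) (digit+unit≤unit n) ⟩
    x n + digitTerm c 1 (k n)
      ≤⟨ partialSum-tail j d ⟩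
    x j + digitTerm c 1 (k j) ∎
    where
    open ≤-Reasoning
    x = partialSum c D k
    n = j ℕ.+ d

  partialSum-≤ : ∀ j d → partialSum c D k (j ℕ.+ d) ≤ partialSum c D k j + digitTerm c 1 (k j)
  partialSum-≤ j d = ≤-trans (p≤p+q _ (0≤digitTerm 1 (k (j ℕ.+ d)))) (partialSum-tail j d)

  partialSum-mono : ∀ j d → partialSum c D k j ≤ partialSum c D k (j ℕ.+ d)
  partialSum-mono j zero rewrite ℕP.+-identityʳ j = ≤-refl
  partialSum-mono j (suc d) rewrite ℕP.+-suc j d =
    ≤-trans (partialSum-mono j d) (p≤p+q _ (0≤digitTerm (D (suc (j ℕ.+ d))) (k (suc (j ℕ.+ d)))))

module Digits where

  open Fractions
  open Growth using (n<m^n)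
  open import Data.Nat as ℕ using (ℕ; zero; suc; NonZero; _^_)
  import Data.Nat.Properties as ℕP
  open import Data.Nat.Divisibility using (_∣_; ∣⇒≤; ∣n⇒∣m*n; m∣m*n; ∣m+n∣m⇒∣n)
  open import Data.Nat.Tactic.RingSolver using (solve-∀)
  open import Data.Integer using (+_)
  open import Data.Rational using (_/_; _+_; _<_)
  open import Data.Product using (_,_)
  open import Data.Empty using (⊥)
  open import Relation.Binary.PropositionalEquality

  separation : ∀ c N₀ D₁ D₂ {k₁ k₂} → 0 ℕ.< k₁ → k₁ ℕ.< k₂ → 0 ℕ.< D₂ → D₂ ℕ.< suc (suc c) →
               digitTerm c D₁ k₁ + digitTerm c D₂ k₂ < digitTerm c N₀ 1 + digitTerm c 1 k₂ →
               digitTerm c N₀ 1 < (digitTerm c D₁ k₁ + digitTerm c D₂ k₂) + digitTerm c 1 k₂ → ⊥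
  separation c N₀ D₁ D₂ {suc a} {k₂} _ k₁<k₂ 0<D₂ D₂<b with ℕP.m≤n⇒∃[o]m+o≡n k₁<k₂
  ... | o , refl = λ S<A+T A<S+T →
    ℕP.<-irrefl refl (ℕP.<-≤-trans D₂<b (∣⇒≤ {{ℕ.>-nonZero 0<D₂}} (b∣D₂ (N≡N₀X S<A+T A<S+T))))
    where
    b = suc (suc c)
    X = b ^ suc (a ℕ.+ o)
    B = b ℕ.* X
    N = D₁ ℕ.* b ^ suc o ℕ.+ D₂
    instance
      B≢0 : NonZero B
      B≢0 = ℕP.m^n≢0 b (suc (suc (a ℕ.+ o)))

    B≡ : B ≡ b ^ suc a ℕ.* b ^ suc o
    B≡ = trans (cong (λ e → b ^ suc e) (sym (ℕP.+-suc a o))) (ℕP.^-distribˡ-+-* b (suc a) (suc o))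

    shift : ∀ x y z → x ℕ.* (y ℕ.* z) ≡ x ℕ.* z ℕ.* y
    shift = solve-∀

    S≡ : digitTerm c D₁ (suc a) + digitTerm c D₂ (suc (suc a ℕ.+ o)) ≡ (+ N) / B
    S≡ = trans (cong (_+ (+ D₂) / B)
                     (cross-≡⇒/≡ D₁ (D₁ ℕ.* b ^ suc o) (b ^ suc a) B {{ℕP.m^n≢0 b (suc a)}}
                                 (trans (cong (D₁ ℕ.*_) B≡) (shift D₁ (b ^ suc a) (b ^ suc o)))))
               (/+/-same (D₁ ℕ.* b ^ suc o) D₂ B)

    A≡ : digitTerm c N₀ 1 ≡ (+ (N₀ ℕ.* X)) / B
    A≡ = cross-≡⇒/≡ N₀ (N₀ ℕ.* X) (b ^ 1) B {{ℕP.m^n≢0 b 1}} (swap N₀ b X)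
      where
      swap : ∀ n y x → n ℕ.* (y ℕ.* x) ≡ n ℕ.* x ℕ.* (y ℕ.* 1)
      swap = solve-∀

    S = digitTerm c D₁ (suc a) + digitTerm c D₂ (suc (suc a ℕ.+ o))
    A = digitTerm c N₀ 1
    T = digitTerm c 1 (suc (suc a ℕ.+ o))

    N≡N₀X : S < A + T → A < S + T → N ≡ N₀ ℕ.* X
    N≡N₀X S<A+T A<S+T = ℕP.≤-antisym (ℕP.≤-pred N<1+N₀X) (ℕP.≤-pred N₀X<1+N)
      where
      N<1+N₀X : N ℕ.< suc (N₀ ℕ.* X)
      N<1+N₀X = /<-same⇒< N _ B (subst₂ _<_ S≡ (trans (cong (_+ T) A≡) (/+1/ (N₀ ℕ.* X) B)) S<A+T)
      N₀X<1+N : N₀ ℕ.* X ℕ.< suc N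
      N₀X<1+N = /<-same⇒< (N₀ ℕ.* X) _ B (subst₂ _<_ A≡ (trans (cong (_+ T) S≡) (/+1/ N B)) A<S+T)

    b∣D₂ : N ≡ N₀ ℕ.* X → b ∣ D₂
    b∣D₂ N≡ = ∣m+n∣m⇒∣n (subst (b ∣_) (sym N≡) (∣n⇒∣m*n N₀ (m∣m*n (b ^ (a ℕ.+ o)))))
                        (∣n⇒∣m*n D₁ (m∣m*n (b ^ o)))

  <position⇒<code : ∀ c d {m k} → 0 ℕ.< d → d ℕ.< suc (suc c) → m ℕ.< k →
                    m ℕ.< codeℚ (digitTerm c d k)
  <position⇒<code c d {m} {suc k} 0<d d<b (ℕ.s≤s m≤k) = begin-strict
    m          ≤⟨ m≤k ⟩
    k          <⟨ n<m^n (ℕ.s≤s (ℕ.s≤s ℕ.z≤n)) k ⟩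
    b ^ k      <⟨ ℕP.*-cancelʳ-< b (b ^ k) den bᵏ*b<den*b ⟩
    den        ≤⟨ ℕP.m≤n+m den _ ⟩
    codeℚ q    ∎
    where
    open ℕP.≤-Reasoning
    b = suc (suc c)
    q = digitTerm c d (suc k)
    den = ℚ.denominatorℕ q
    bᵏ*b<den*b : b ^ k ℕ.* b ℕ.< den ℕ.* b
    bᵏ*b<den*b = begin-strict
      b ^ k ℕ.* b   ≡⟨ ℕP.*-comm (b ^ k) b ⟩
      b ^ suc k     ≤⟨ ≤denominator* d (b ^ suc k) {{ℕP.m^n≢0 b (suc k)}} 0<d ⟩
      den ℕ.* d     <⟨ ℕP.*-monoʳ-< den d<b ⟩
      den ℕ.* b     ∎

module SecondDigit (f : ℕ → ℕ) (f-step : ∀ x → f x ℕ.≤ f (suc x)) (f≥1 : ∀ x → 1 ℕ.≤ f x) where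

  open Growth using (module Increasing)
  open Increasing f f-step f≥1 using (αden-growth)
  open Fractions
  open Limits using (limit-gap; SameLimit-sym; +-cancelʳ-<)
  open AlphaBounds
  open Digits using (separation; <position⇒<code)
  open import Data.Nat using (_^_)
  import Data.Nat.Properties as ℕP
  open import Data.Nat.Tactic.RingSolver using (solve-∀)
  open import Data.Integer using (+_)
  open import Data.Rational using (_/_; _+_; _≤_; _<_; 0ℚ)
  open import Data.Rational.Properties
  open import Data.Product using (∃; proj₁; proj₂)
  open import Data.Vec using ([]; _∷_)
  open import Relation.Binary.PropositionalEquality

  module _ (i c : ℕ) (b≡2Q : suc (suc c) ≡ 2 ℕ.* αden f i) where

    αprefix-digit : ∃ λ N₀ → αprefix f i ≡ digitTerm c N₀ 1
    αprefix-digit with αprefix-/ f i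
    ... | M , eq = 2 ℕ.* M , trans eq (cross-≡⇒/≡ M (2 ℕ.* M) (αden f i) (suc (suc c) ^ 1)
                                          {{αden-nonZero f i}} {{ℕP.m^n≢0 (suc (suc c)) 1}} cross)
      where
      shuffle : ∀ m q → m ℕ.* ((2 ℕ.* q) ℕ.* 1) ≡ 2 ℕ.* m ℕ.* q
      shuffle = solve-∀
      cross : M ℕ.* (suc (suc c) ^ 1) ≡ 2 ℕ.* M ℕ.* αden f i
      cross = trans (cong (λ b → M ℕ.* (b ℕ.* 1)) b≡2Q) (shuffle M (αden f i))

    thrice-½^≤ : ∀ {K} → K ℕ.≤ f i → (½^ (hfun f i) + ½^ (hfun f i)) + ½^ (hfun f i) ≤ digitTerm c 1 K
    thrice-½^≤ {K} K≤fi = begin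
      (½^ h + ½^ h) + ½^ h   ≡⟨ cong (_+ ½^ h) (/+/-same 1 1 (2 ^ h)) ⟩
      (+ 2) / 2 ^ h + ½^ h   ≡⟨ /+/-same 2 1 (2 ^ h) ⟩
      (+ 3) / 2 ^ h          ≤⟨ cross-≤⇒/≤ 3 1 (2 ^ h) (b ^ K) {{2ʰ≢0}} {{ℕP.m^n≢0 b K}} 3bᴷ≤2ʰ ⟩
      digitTerm c 1 K        ∎
      where
      open ≤-Reasoning
      h = hfun f i
      b = suc (suc c)
      instance
        2ʰ≢0 : ℕ.NonZero (2 ^ h)
        2ʰ≢0 = ℕP.m^n≢0 2 h
      3bᴷ≤2ʰ : 3 ℕ.* b ^ K ℕ.≤ 1 ℕ.* 2 ^ h
      3bᴷ≤2ʰ = ℕP.≤-trans (ℕP.*-monoʳ-≤ 3 (ℕP.^-monoʳ-≤ b K≤fi))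
                 (subst (λ x → 3 ℕ.* x ^ f i ℕ.≤ 1 ℕ.* 2 ^ h) (sym b≡2Q)
                        (ℕP.≤-trans (αden-growth i) (ℕP.≤-reflexive (sym (ℕP.*-identityˡ (2 ^ h))))))

  f<secondPosition : ∀ i c D k → suc (suc c) ≡ 2 ℕ.* αden f i → IsExpansion (αseq f) c D k → f i ℕ.< k 2
  f<secondPosition i c D k b≡2Q (digits , k₀≡0 , k-< , close) = ℕP.≰⇒> λ k₂≤fi →
    separation c N₀ (D 1) (D 2) 0<k₁ (k-< 1) (proj₁ (digits 1)) (proj₂ (digits 1))
               (S<A+T k₂≤fi) A<S+T
    where
    open Expansion c D k (λ j → proj₂ (digits j)) k-<
    N₀ = proj₁ (αprefix-digit i c b≡2Q)
    A = digitTerm c N₀ 1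
    S = digitTerm c (D 1) (k 1) + digitTerm c (D 2) (k 2)
    T = digitTerm c 1 (k 2)
    p = Pinv i (hfun f i)
    e = ½^ (hfun f i)

    A≡ : αprefix f i ≡ A
    A≡ = proj₂ (αprefix-digit i c b≡2Q)

    S≡ : partialSum c D k 2 ≡ S
    S≡ = cong (_+ digitTerm c (D 2) (k 2)) (+-identityˡ (digitTerm c (D 1) (k 1)))

    0<p : 0ℚ < p
    0<p = 0<1/ (P i ^ hfun f i) {{ℕP.m^n≢0 (P i) (hfun f i) {{P-nz i}}}}

    0<k₁ : 0 ℕ.< k 1
    0<k₁ = subst (ℕ._< k 1) k₀≡0 (k-< 0)

    S<A+T : k 2 ℕ.≤ f i → S < A + T
    S<A+T k₂≤fi = begin-strict
      S                    ≡⟨ S≡ ⟨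
      partialSum c D k 2   <⟨ limit-gap {partialSum c D k} {αseq f} 2 i close 0<p (partialSum-mono 2) αseq≤ ⟩
      (A + (e + e)) + p    ≤⟨ +-monoʳ-≤ (A + (e + e)) (Pinv≤½^ i (hfun f i)) ⟩
      (A + (e + e)) + e    ≡⟨ +-assoc A (e + e) e ⟩
      A + ((e + e) + e)    ≤⟨ +-monoʳ-≤ A (thrice-½^≤ i c b≡2Q k₂≤fi) ⟩
      A + T                ∎
      where
      open ≤-Reasoning
      αseq≤ : ∀ n → αseq f (i ℕ.+ n) ≤ A + (e + e)
      αseq≤ n = subst (λ x → αseq f (i ℕ.+ n) ≤ x + (e + e)) A≡ (αseq-≤ f f-step i n)

    A<S+T : A < S + T
    A<S+T = +-cancelʳ-< p (limit-gap {αseq f} {partialSum c D k} i 2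
                              (SameLimit-sym {partialSum c D k} close) 0<p αseq≥ partialSum≤)
      where
      αseq≥ : ∀ m → A + p ≤ αseq f (i ℕ.+ m)
      αseq≥ m = subst (λ x → x + p ≤ αseq f (i ℕ.+ m)) A≡ (αseq-≥ f i m)
      partialSum≤ : ∀ n → partialSum c D k (2 ℕ.+ n) ≤ S + T
      partialSum≤ n = subst (λ x → partialSum c D k (2 ℕ.+ n) ≤ x + T) S≡ (partialSum-≤ 2 n)

  f<code : ∀ G → IsGhat (αseq f) G → ∀ i → f i ℕ.< suc (oracle G (2 ℕ.* αden f i ∷ 2 ∷ []))
  f<code G (_ , _ , expansions) i =
    let (D , k , expansion , G≡digit) = expansions c
        (digits , _) = expansion
    in subst (λ b → f i ℕ.< suc (oracle G (b ∷ 2 ∷ []))) b≡2Q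
         (ℕP.m<n⇒m<1+n (subst (λ q → f i ℕ.< codeℚ q) (sym (G≡digit 1))
           (<position⇒<code c (D 2) (proj₁ (digits 1)) (proj₂ (digits 1))
                            (f<secondPosition i c D k b≡2Q expansion))))
    where
    c = 2 ℕ.* αden f i ℕ.∸ 2
    b≡2Q : suc (suc c) ≡ 2 ℕ.* αden f i
    b≡2Q = ℕP.m+[n∸m]≡n (ℕP.*-monoʳ-≤ 2 (ℕ.>-nonZero⁻¹ (αden f i) {{αden-nonZero f i}}))

theorem2 : (f : ℕ → ℕ) → Honest f →
    (G : ℕ → ℕ → ℚ) → IsGhat (αseq f) G →
    PRin (oracle G) 1 (λ v → f (head v))
theorem2 f (f-step , 2ˣ≤f , graph) G ghat =
  pr-ext (αden-bounded⇒PR f graph bound bound-PR (SecondDigit.f<code f f-step f≥1 G ghat))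
         (λ { (x ∷ []) → refl })
  where
  open PrimitiveRecursive (oracle G)
  open Data.Nat.Properties using (≤-trans; m^n>0)
  f≥1 : ∀ x → 1 ℕ.≤ f x
  f≥1 x = ≤-trans (m^n>0 2 x) (2ˣ≤f x)
  bound : ℕ → ℕ
  bound q = suc (oracle G (2 ℕ.* q ∷ 2 ∷ []))
  bound-PR : PR₁ bound
  bound-PR = sucᴾ (pr-comp pr-oracle (const 2 *ᴾ x₀ ∷ const 2 ∷ []))
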